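{- Let $n\ge2$ and let $\mathcal{G}$ be the Sprague–Grundy function of Exco-Nim with parameter $n$. Then $\mathcal{G}(x_0,x_1,\ldots,x_n)$ is strictly increasing in $x_0$: if $x'_0>x''_0$ then $\mathcal{G}(x'_0,x_1,\ldots,x_n)>\mathcal{G}(x''_0,x_1,\ldots,x_n)$ for all nonnegative integers $x_1,\ldots,x_n$.
   Context: Exco-Nim with parameter $n\ge2$: positions are tuples $x=(x_0,x_1,\ldots,x_n)$ of nonnegative integers. A legal move $x\to x'$ is to a tuple $x'$ of nonnegative integers with $x'_j\le x_j$ for all $j$, $\sum_j x'_j<\sum_j x_j$, and $x'_i=x_i$ for at least one index $1\le i\le n$. The Sprague–Grundy function is defined recursively by $\mathcal{G}(x)=\operatorname{mex}\{\mathcal{G}(x'): x\to x'\}$, where $\operatorname{mex}(S)$ is the smallest nonnegative integer not in $S$. -}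

module Defs where

open import Data.Nat using (ℕ; zero; suc; _+_; _≤_; _<_; _≤?_; _<?_; _≟_)
open import Data.Bool using (Bool; true; false; _∧_; _∨_; not)
open import Data.List using (List; []; _∷_; map; filterᵇ; concatMap; upTo; length)
open import Data.Bool.ListAction using (any)
open import Data.Vec using (Vec; []; _∷_; sum; toList)
open import Relation.Nullary.Decidable using (⌊_⌋)

elemℕ : ℕ → List ℕ → Bool
elemℕ k l = any (λ m → ⌊ k ≟ m ⌋) l

-- mex: smallest natural number not in the list.
-- Searching k = 0, 1, ..., length l suffices (pigeonhole); we search with
-- fuel (suc (length l)); the search always succeeds within that range.
mexSearch : ℕ → ℕ → List ℕ → ℕ
mexSearch zero k l = k
mexSearch (suc f) k l with elemℕ k l
... | true  = mexSearch f (suc k) l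
... | false = k

mex : List ℕ → ℕ
mex l = mexSearch (suc (length l)) 0 l

below : ∀ {k} → Vec ℕ k → List (Vec ℕ k)
below [] = [] ∷ []
below (a ∷ x) = concatMap (λ b → map (b ∷_) (below x)) (upTo (suc a))

someEqual : ∀ {k} → Vec ℕ k → Vec ℕ k → Bool
someEqual [] [] = false
someEqual (a ∷ x) (b ∷ y) = ⌊ a ≟ b ⌋ ∨ someEqual x y

-- Exco-Nim positions with parameter n: vectors (x₀ ∷ x₁ … xₙ) of length suc n.
-- A legal move x → x' (x' already assumed componentwise ≤ x):
--   sum x' < sum x, and x'ᵢ = xᵢ for some 1 ≤ i ≤ n (index 0 excluded).
legalᵇ : ∀ {n} → Vec ℕ (suc n) → Vec ℕ (suc n) → Bool
legalᵇ (a ∷ x) (b ∷ y) = ⌊ sum (b ∷ y) <? sum (a ∷ x) ⌋ ∧ someEqual x y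

options : ∀ {n} → Vec ℕ (suc n) → List (Vec ℕ (suc n))
options x = filterᵇ (legalᵇ x) (below x)

-- Grundy recursion with fuel; fuel = sum x is always enough since every
-- move strictly decreases the total.
grundyF : ∀ {n} → ℕ → Vec ℕ (suc n) → ℕ
grundyF zero x = 0
grundyF (suc f) x = mex (map (grundyF f) (options x))

𝒢 : ∀ {n} → Vec ℕ (suc n) → ℕ
𝒢 x = grundyF (sum x) x

module Submission where

-- Idea.  Lowering x₀ from a to b < a never creates moves: every option of
-- (b, x) is also an option of (a, x), since the componentwise bound and the
-- "some xᵢ (i ≥ 1) unchanged" condition only get weaker, and the total only
-- grows.  Moreover (b, x) is itself an option of (a, x) as long as x has a
-- coordinate at all (it is left unchanged).  The general fact about mex is:
-- if L ⊆ M and mex L ∈ M then mex L < mex M.  Applied to the lists of Grundy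
-- values of the options, this gives 𝒢(b, x) < 𝒢(a, x).

open import Defs
open import Data.Nat using (ℕ; zero; suc; _+_; _≤_; _<_; _≤?_; _<?_; _≟_; s≤s; s≤s⁻¹)
open import Data.Nat.Properties
open import Data.Bool using (true; false; T; T?)
open import Data.Bool.Properties using (T-∧)
open import Data.List using (List; []; _∷_; map; length; lookup)
open import Data.List.Membership.Propositional using (_∈_; _∉_; find; lose)
open import Data.List.Membership.Propositional.Properties
  using (∈-filter⁺; ∈-filter⁻; ∈-map⁺; ∈-map⁻; ∈-concatMap⁺; ∈-concatMap⁻; ∈-upTo⁺; ∈-upTo⁻)
open import Data.List.Relation.Unary.Any using (here; there; index)
open import Data.List.Relation.Unary.Any.Properties using (lookup-index)
open import Data.List.Relation.Unary.All using (tabulate)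
open import Data.List.Properties using (map-cong-local)
open import Data.Vec using (Vec; []; _∷_; sum)
open import Data.Vec.Properties using (∷-injective)
open import Data.Fin using (Fin; toℕ)
open import Data.Fin.Properties using (pigeonhole; toℕ<n)
open import Data.Product using (_×_; _,_; proj₁; proj₂)
open import Data.Sum using (_⊎_; inj₁; inj₂)
open import Data.Empty using (⊥-elim)
open import Data.Unit using (tt)
open import Relation.Nullary using (yes; no)
open import Relation.Nullary.Decidable using (⌊_⌋; toWitness; fromWitness)
open import Relation.Binary.PropositionalEquality using (_≡_; refl; sym; trans; cong; subst)
open import Function.Bundles using (Equivalence; _⇔_; mk⇔)

elemℕ-true : ∀ k l → elemℕ k l ≡ true → k ∈ l
elemℕ-true k []      ()
elemℕ-true k (m ∷ l) eq with k ≟ m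
... | yes k≡m = here k≡m
... | no  _   = there (elemℕ-true k l eq)

elemℕ-false : ∀ k l → elemℕ k l ≡ false → k ∉ l
elemℕ-false k (m ∷ l) eq k∈ with k ≟ m | k∈
elemℕ-false k (m ∷ l) () _ | yes _  | _
... | no k≢m | here k≡m = k≢m k≡m
... | no _   | there k∈l = elemℕ-false k l eq k∈l

-- Pigeonhole: a list containing each of 0, …, N-1 has length at least N,
-- because their first positions in the list are pairwise distinct.
covers⇒length : ∀ N (l : List ℕ) → (∀ j → j < N → j ∈ l) → N ≤ length l
covers⇒length N l covers with N ≤? length l
... | yes N≤len = N≤len
... | no  N≰len with pigeonhole (≰⇒> N≰len) position
  where
    position : Fin N → Fin (length l)
    position i = index (covers (toℕ i) (toℕ<n i))
... | i , j , i<j , same = ⊥-elim (<-irrefl i≡j i<j)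
  where
    i≡j : toℕ i ≡ toℕ j
    i≡j = trans (lookup-index (covers (toℕ i) (toℕ<n i)))
            (trans (cong (lookup l) same) (sym (lookup-index (covers (toℕ j) (toℕ<n j)))))

-- Invariant of the search: started at k with all j < k in l, mexSearch
-- returns a value r with all j < r in l, and r is either absent from l or
-- the search ran out of fuel at r = k + fuel.
mexSearch-spec : ∀ f k l → (∀ j → j < k → j ∈ l) →
  (∀ j → j < mexSearch f k l → j ∈ l) × (mexSearch f k l ∉ l ⊎ mexSearch f k l ≡ k + f)
mexSearch-spec zero    k l below-k = below-k , inj₂ (sym (+-identityʳ k))
mexSearch-spec (suc f) k l below-k with elemℕ k l in k∈?
... | false = below-k , inj₁ (elemℕ-false k l k∈?)
... | true with mexSearch-spec f (suc k) l below-suc-k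
  where
    below-suc-k : ∀ j → j < suc k → j ∈ l
    below-suc-k j j<1+k with m≤n⇒m<n∨m≡n (s≤s⁻¹ j<1+k)
    ... | inj₁ j<k  = below-k j j<k
    ... | inj₂ refl = elemℕ-true k l k∈?
... | below-r , inj₁ r∉l = below-r , inj₁ r∉l
... | below-r , inj₂ r≡  = below-r , inj₂ (trans r≡ (sym (+-suc k f)))

mex-below : ∀ l j → j < mex l → j ∈ l
mex-below l = proj₁ (mexSearch-spec (suc (length l)) 0 l (λ _ ()))

-- mex l does not occur in l: running out of fuel would mean 0, …, length l
-- all occur in l, contradicting the pigeonhole bound.
mex-notin : ∀ l → mex l ∉ l
mex-notin l with mexSearch-spec (suc (length l)) 0 l (λ _ ())
... | _       , inj₁ r∉l = r∉l
... | below-r , inj₂ r≡  = λ _ → <-irrefl refl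
  (covers⇒length (suc (length l)) l (λ j j< → below-r j (subst (j <_) (sym r≡) j<)))

mex-above : ∀ l m → (∀ j → j ≤ m → j ∈ l) → m < mex l
mex-above l m covers with m <? mex l
... | yes m<mex = m<mex
... | no  m≮mex = ⊥-elim (mex-notin l (covers (mex l) (≮⇒≥ m≮mex)))

mex-grows : ∀ L M → (∀ {j} → j ∈ L → j ∈ M) → mex L ∈ M → mex L < mex M
mex-grows L M L⊆M mexL∈M = mex-above M (mex L) covers
  where
    covers : ∀ j → j ≤ mex L → j ∈ M
    covers j j≤ with m≤n⇒m<n∨m≡n j≤
    ... | inj₁ j<mex = L⊆M (mex-below L j j<mex)
    ... | inj₂ refl  = mexL∈M

below-cons⁻ : ∀ {k c a} {y x : Vec ℕ k} → (c ∷ y) ∈ below (a ∷ x) → c ≤ a × y ∈ below x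
below-cons⁻ {x = x} c∷y∈ with find (∈-concatMap⁻ (λ b → map (b ∷_) (below x)) c∷y∈)
... | b , b∈ , b∷y∈ with ∈-map⁻ (b ∷_) b∷y∈
... | z , z∈ , c∷y≡b∷z with ∷-injective c∷y≡b∷z
... | refl , refl = s≤s⁻¹ (∈-upTo⁻ b∈) , z∈

below-cons⁺ : ∀ {k c a} {y x : Vec ℕ k} → c ≤ a → y ∈ below x → (c ∷ y) ∈ below (a ∷ x)
below-cons⁺ {c = c} {x = x} c≤a y∈ =
  ∈-concatMap⁺ (λ b → map (b ∷_) (below x)) (lose (∈-upTo⁺ (s≤s c≤a)) (∈-map⁺ (c ∷_) y∈))

below-refl : ∀ {k} (x : Vec ℕ k) → x ∈ below x
below-refl []      = here refl
below-refl (a ∷ x) = below-cons⁺ {c = a} {a} {x} {x} ≤-refl (below-refl x)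

legal⇔ : ∀ {n} a c (x y : Vec ℕ n) →
  T (legalᵇ (a ∷ x) (c ∷ y)) ⇔ (c + sum y < a + sum x × T (someEqual x y))
legal⇔ _ _ _ _ = mk⇔ (λ t → let (lt , keep) = Equivalence.to T-∧ t in toWitness lt , keep)
             (λ (lt , keep) → Equivalence.from T-∧ (fromWitness lt , keep))

options⁻ : ∀ {n} (x y : Vec ℕ (suc n)) → y ∈ options x → y ∈ below x × T (legalᵇ x y)
options⁻ x _ = ∈-filter⁻ (λ v → T? (legalᵇ x v))

options⁺ : ∀ {n} (x y : Vec ℕ (suc n)) → y ∈ below x → T (legalᵇ x y) → y ∈ options x
options⁺ x _ = ∈-filter⁺ (λ v → T? (legalᵇ x v))

options-sum : ∀ {n} (x y : Vec ℕ (suc n)) → y ∈ options x → sum y < sum x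
options-sum (a ∷ x) (c ∷ y) y∈ = proj₁ (Equivalence.to (legal⇔ a c x y) (proj₂ (options⁻ (a ∷ x) (c ∷ y) y∈)))

options-terminal : ∀ {n} (x : Vec ℕ (suc n)) → sum x ≤ 0 → options x ≡ []
options-terminal x sum≤0 with options x in eq
... | []    = refl
... | y ∷ _ = ⊥-elim (n≮0 (<-≤-trans (options-sum x y (subst (y ∈_) (sym eq) (here refl))) sum≤0))

grundyF-fuel : ∀ {n} f g (x : Vec ℕ (suc n)) → sum x ≤ f → sum x ≤ g → grundyF f x ≡ grundyF g x
grundyF-fuel zero    zero    x _ _ = refl
grundyF-fuel zero    (suc g) x p _ rewrite options-terminal x p = refl
grundyF-fuel (suc f) zero    x _ q rewrite options-terminal x q = refl
grundyF-fuel (suc f) (suc g) x p q = cong mex (map-cong-local (tabulate λ {y} y∈ →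
  let y<x = options-sum x y y∈ in
  grundyF-fuel f g y (s≤s⁻¹ (<-≤-trans y<x p)) (s≤s⁻¹ (<-≤-trans y<x q))))

𝒢-rec : ∀ {n} (x : Vec ℕ (suc n)) → 𝒢 x ≡ mex (map 𝒢 (options x))
𝒢-rec x = trans (grundyF-fuel (sum x) (suc (sum x)) x ≤-refl (n≤1+n _))
  (cong mex (map-cong-local (tabulate λ {y} y∈ →
    grundyF-fuel (sum x) (sum y) y (<⇒≤ (options-sum x y y∈)) ≤-refl)))

-- Raising x₀ keeps every move available: the bound on the new x₀ and the
-- drop of the total only become easier to satisfy.
options-mono : ∀ {n a b} (x : Vec ℕ n) → b ≤ a →
  ∀ y → y ∈ options (b ∷ x) → y ∈ options (a ∷ x)
options-mono {a = a} {b} x b≤a (c ∷ y) y∈ with options⁻ (b ∷ x) (c ∷ y) y∈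
... | c∷y∈below , legal with below-cons⁻ {c = c} {b} {y} {x} c∷y∈below | Equivalence.to (legal⇔ b c x y) legal
... | c≤b , y∈below | total< , keep =
  options⁺ (a ∷ x) (c ∷ y) (below-cons⁺ {c = c} {a} {y} {x} (≤-trans c≤b b≤a) y∈below)
    (Equivalence.from (legal⇔ a c x y) (<-≤-trans total< (+-monoˡ-≤ (sum x) b≤a) , keep))

someEqual-refl : ∀ {k} (h : ℕ) (t : Vec ℕ k) → T (someEqual (h ∷ t) (h ∷ t))
someEqual-refl h t with h ≟ h
... | yes _   = tt
... | no  h≢h = ⊥-elim (h≢h refl)

options-lower-x₀ : ∀ {k a b} (h : ℕ) (t : Vec ℕ k) → b < a → (b ∷ h ∷ t) ∈ options (a ∷ h ∷ t)
options-lower-x₀ {a = a} {b} h t b<a =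
  options⁺ (a ∷ h ∷ t) (b ∷ h ∷ t) (below-cons⁺ {c = b} {a} {h ∷ t} {h ∷ t} (<⇒≤ b<a) (below-refl (h ∷ t)))
    (Equivalence.from (legal⇔ a b (h ∷ t) (h ∷ t)) (+-monoˡ-< (sum (h ∷ t)) b<a , someEqual-refl h t))

-- Strict monotonicity in x₀ holds already for n ≥ 1.
𝒢-strictMono-x₀ : ∀ {k a b} (h : ℕ) (t : Vec ℕ k) → b < a → 𝒢 (b ∷ h ∷ t) < 𝒢 (a ∷ h ∷ t)
𝒢-strictMono-x₀ {a = a} {b} h t b<a
  rewrite 𝒢-rec (b ∷ h ∷ t) | 𝒢-rec (a ∷ h ∷ t) =
    mex-grows (map 𝒢 (options (b ∷ h ∷ t))) (map 𝒢 (options (a ∷ h ∷ t))) valuesIncluded lowerValue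
  where
    valuesIncluded : ∀ {j} → j ∈ map 𝒢 (options (b ∷ h ∷ t)) → j ∈ map 𝒢 (options (a ∷ h ∷ t))
    valuesIncluded j∈ with ∈-map⁻ 𝒢 j∈
    ... | y , y∈ , refl = ∈-map⁺ 𝒢 (options-mono (h ∷ t) (<⇒≤ b<a) y y∈)

    lowerValue : mex (map 𝒢 (options (b ∷ h ∷ t))) ∈ map 𝒢 (options (a ∷ h ∷ t))
    lowerValue = subst (_∈ map 𝒢 (options (a ∷ h ∷ t))) (𝒢-rec (b ∷ h ∷ t))
                   (∈-map⁺ 𝒢 (options-lower-x₀ h t b<a))

lemma2p3 : (n : ℕ) → 2 ≤ n → (x : Vec ℕ n) → (a b : ℕ) →
    b < a → 𝒢 {n} (b ∷ x) < 𝒢 {n} (a ∷ x)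
lemma2p3 (suc _) _ (h ∷ t) a b b<a = 𝒢-strictMono-x₀ h t b<a
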